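{- Let $G$ be a finite simple graph and let $X$ be an independent set of $G$ with $d(X)>0$ such that $d(Y)<d(X)$ for every proper subset $Y\subsetneq X$. Then $X\subseteq \ker(G)$.
   Context: For $A \subseteq V(G)$, $N(A)$ is the set of vertices adjacent to some vertex of $A$; $d(A)=|A|-|N(A)|$; $d_c(G)=\max\{d(A):A\subseteq V(G)\}$; a set $A$ is critical if $d(A)=d_c(G)$; $\ker(G)$ is the intersection of all critical sets of $G$. -}

module Defs where

open import Data.Nat using (ℕ)
open import Data.Bool using (Bool; true; false)
open import Data.Fin using (Fin)
open import Data.Fin.Subset using (Subset; _∈_; _⊆_; _⊂_; ∣_∣; outside; inside)
open import Data.Vec using (tabulate; lookup)
open import Data.Vec.Relation.Unary.Any using (Any)
open import Data.Integer using (ℤ; +_; _-_; _<_; _≤_; 0ℤ)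
open import Data.Product using (_×_)
open import Relation.Binary.PropositionalEquality using (_≡_)
open import Relation.Nullary using (¬_)

record Graph (n : ℕ) : Set where
  field
    adj   : Fin n → Fin n → Bool
    sym   : ∀ u v → adj u v ≡ adj v u
    irrefl : ∀ v → adj v v ≡ false
open Graph public

isNbr : ∀ {n} → Graph n → Subset n → Fin n → Bool
isNbr {n} G A v = anyB (tabulate λ u → lookup A u Data.Bool.∧ adj G u v)
  where
  open import Data.Vec using (Vec; foldr)
  anyB : ∀ {m} → Vec Bool m → Bool
  anyB = foldr _ Data.Bool._∨_ false

N : ∀ {n} → Graph n → Subset n → Subset n
N G A = tabulate (isNbr G A)

d : ∀ {n} → Graph n → Subset n → ℤ
d G A = + ∣ A ∣ - + ∣ N G A ∣

Independent : ∀ {n} → Graph n → Subset n → Set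
Independent G A = ∀ u v → u ∈ A → v ∈ A → adj G u v ≡ false

Critical : ∀ {n} → Graph n → Subset n → Set
Critical G A = ∀ B → d G B ≤ d G A

_∈ker_ : ∀ {n} → Fin n → Graph n → Set
x ∈ker G = ∀ A → Critical G A → x ∈ A

-- d is supermodular: |A ∪ B| + |A ∩ B| = |A| + |B| while N(A ∪ B) ⊆ N(A) ∪ N(B) and
-- N(A ∩ B) ⊆ N(A) ∩ N(B), so d(A) + d(B) ≤ d(A ∪ B) + d(A ∩ B).  If A is critical and
-- x ∈ X lies outside A, then A ∩ X ⊊ X, so d(A ∪ X) + d(A ∩ X) < d(A) + d(X) by
-- criticality of A and minimality of X, contradicting supermodularity.
module Submission where

open import Defs hiding (sym)
open import Data.Nat using (ℕ)
open import Data.Fin using (Fin)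
open import Data.Fin.Subset using (Subset; _∈_; _⊂_)
open import Data.Integer using (0ℤ; _<_)

import Data.Nat as ℕ
import Data.Nat.Properties as ℕ
open import Data.Integer using (ℤ; +_; +≤+; _+_; _-_; _≤_)
open import Data.Integer.Properties
  using (pos-+; +-monoʳ-≤; neg-mono-≤; +-mono-≤-<; <⇒≱; module ≤-Reasoning)
open import Data.Integer.Tactic.RingSolver using (solve-∀)
open import Data.Bool using (Bool; true; false; _∧_; _∨_)
open import Data.Vec using (_∷_; []; foldr; tabulate; lookup)
open import Data.Vec.Properties using (lookup∘tabulate; []=⇒lookup; lookup⇒[]=)
open import Data.Fin.Subset using (_∩_; _∪_; _⊆_; ∣_∣; inside; outside)
open import Data.Fin.Subset.Properties
  using (_∈?_; p⊆q⇒∣p∣≤∣q∣; p∩q⊆p; p∩q⊆q; x∈p∩q⁺; x∈p∩q⁻; x∈p∪q⁺; x∈p∪q⁻)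
open import Data.Product using (∃; _×_; _,_; proj₁)
open import Data.Sum using (inj₁; inj₂)
open import Function using (_∘_)
open import Relation.Binary.PropositionalEquality using (_≡_; refl; sym; trans; cong; cong₂)
open import Relation.Nullary using (yes; no; contradiction)

any-tabulate⁻ : ∀ {m} (f : Fin m → Bool) →
  foldr _ _∨_ false (tabulate f) ≡ true → ∃ λ i → f i ≡ true
any-tabulate⁻ {ℕ.suc m} f any with f Fin.zero in fzero
... | true  = Fin.zero , fzero
... | false with any-tabulate⁻ (f ∘ Fin.suc) any
...   | i , fi = Fin.suc i , fi

any-tabulate⁺ : ∀ {m} (f : Fin m → Bool) i → f i ≡ true → foldr _ _∨_ false (tabulate f) ≡ true
any-tabulate⁺ f Fin.zero    fi rewrite fi = refl
any-tabulate⁺ f (Fin.suc i) fi with f Fin.zero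
... | true  = refl
... | false = any-tabulate⁺ (f ∘ Fin.suc) i fi

∈-tabulate⁻ : ∀ {m} (f : Fin m → Bool) {x} → x ∈ tabulate f → f x ≡ true
∈-tabulate⁻ f {x} x∈ = trans (sym (lookup∘tabulate f x)) ([]=⇒lookup x∈)

∈-tabulate⁺ : ∀ {m} (f : Fin m → Bool) {x} → f x ≡ true → x ∈ tabulate f
∈-tabulate⁺ f {x} fx = lookup⇒[]= x _ (trans (lookup∘tabulate f x) fx)

∧-true⁻ : ∀ {a b} → a ∧ b ≡ true → a ≡ true × b ≡ true
∧-true⁻ {true} {true} _ = refl , refl

∈N⁻ : ∀ {n} (G : Graph n) A {v} → v ∈ N G A → ∃ λ u → u ∈ A × adj G u v ≡ true
∈N⁻ G A {v} v∈NA with any-tabulate⁻ _ (∈-tabulate⁻ (isNbr G A) v∈NA)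
... | u , uAv with ∧-true⁻ {lookup A u} uAv
...   | u∈A , u~v = u , lookup⇒[]= u A u∈A , u~v

∈N⁺ : ∀ {n} (G : Graph n) A {u v} → u ∈ A → adj G u v ≡ true → v ∈ N G A
∈N⁺ G A {u} {v} u∈A u~v = ∈-tabulate⁺ (isNbr G A)
  (any-tabulate⁺ (λ w → lookup A w ∧ adj G w v) u (cong₂ _∧_ ([]=⇒lookup u∈A) u~v))

N-mono : ∀ {n} (G : Graph n) {A B} → A ⊆ B → N G A ⊆ N G B
N-mono G {A} {B} A⊆B v∈NA with ∈N⁻ G A v∈NA
... | u , u∈A , u~v = ∈N⁺ G B (A⊆B u∈A) u~v

N-∪-⊆ : ∀ {n} (G : Graph n) A B → N G (A ∪ B) ⊆ N G A ∪ N G B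
N-∪-⊆ G A B v∈N with ∈N⁻ G (A ∪ B) v∈N
... | u , u∈A∪B , u~v with x∈p∪q⁻ A B u∈A∪B
...   | inj₁ u∈A = x∈p∪q⁺ (inj₁ (∈N⁺ G A u∈A u~v))
...   | inj₂ u∈B = x∈p∪q⁺ (inj₂ (∈N⁺ G B u∈B u~v))

N-∩-⊆ : ∀ {n} (G : Graph n) A B → N G (A ∩ B) ⊆ N G A ∩ N G B
N-∩-⊆ G A B v∈N = x∈p∩q⁺ (N-mono G (p∩q⊆p A B) v∈N , N-mono G (p∩q⊆q A B) v∈N)

∣p∪q∣+∣p∩q∣≡∣p∣+∣q∣ : ∀ {n} (p q : Subset n) → ∣ p ∪ q ∣ ℕ.+ ∣ p ∩ q ∣ ≡ ∣ p ∣ ℕ.+ ∣ q ∣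
∣p∪q∣+∣p∩q∣≡∣p∣+∣q∣ []            []            = refl
∣p∪q∣+∣p∩q∣≡∣p∣+∣q∣ (inside ∷ p)  (inside ∷ q)  =
  cong ℕ.suc (trans (ℕ.+-suc _ _) (trans (cong ℕ.suc (∣p∪q∣+∣p∩q∣≡∣p∣+∣q∣ p q)) (sym (ℕ.+-suc _ _))))
∣p∪q∣+∣p∩q∣≡∣p∣+∣q∣ (inside ∷ p)  (outside ∷ q) = cong ℕ.suc (∣p∪q∣+∣p∩q∣≡∣p∣+∣q∣ p q)
∣p∪q∣+∣p∩q∣≡∣p∣+∣q∣ (outside ∷ p) (inside ∷ q)  =
  trans (cong ℕ.suc (∣p∪q∣+∣p∩q∣≡∣p∣+∣q∣ p q)) (sym (ℕ.+-suc _ _))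
∣p∪q∣+∣p∩q∣≡∣p∣+∣q∣ (outside ∷ p) (outside ∷ q) = ∣p∪q∣+∣p∩q∣≡∣p∣+∣q∣ p q

∣N∪∣+∣N∩∣≤∣N∣+∣N∣ : ∀ {n} (G : Graph n) A B →
  ∣ N G (A ∪ B) ∣ ℕ.+ ∣ N G (A ∩ B) ∣ ℕ.≤ ∣ N G A ∣ ℕ.+ ∣ N G B ∣
∣N∪∣+∣N∩∣≤∣N∣+∣N∣ G A B = begin
  ∣ N G (A ∪ B) ∣ ℕ.+ ∣ N G (A ∩ B) ∣
    ≤⟨ ℕ.+-mono-≤ (p⊆q⇒∣p∣≤∣q∣ (N-∪-⊆ G A B)) (p⊆q⇒∣p∣≤∣q∣ (N-∩-⊆ G A B)) ⟩
  ∣ N G A ∪ N G B ∣ ℕ.+ ∣ N G A ∩ N G B ∣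
    ≡⟨ ∣p∪q∣+∣p∩q∣≡∣p∣+∣q∣ (N G A) (N G B) ⟩
  ∣ N G A ∣ ℕ.+ ∣ N G B ∣ ∎
  where open ℕ.≤-Reasoning

+-[m-n]+[p-q]≡[m+p]-[n+q] : ∀ m n p q → (+ m - + n) + (+ p - + q) ≡ + (m ℕ.+ p) - + (n ℕ.+ q)
+-[m-n]+[p-q]≡[m+p]-[n+q] m n p q =
  trans (interchange (+ m) (+ n) (+ p) (+ q)) (sym (cong₂ _-_ (pos-+ m p) (pos-+ n q)))
  where
  interchange : ∀ (i j k l : ℤ) → (i - j) + (k - l) ≡ (i + k) - (j + l)
  interchange = solve-∀

d-supermodular : ∀ {n} (G : Graph n) A B → d G A + d G B ≤ d G (A ∪ B) + d G (A ∩ B)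
d-supermodular G A B = begin
  d G A + d G B
    ≡⟨ +-[m-n]+[p-q]≡[m+p]-[n+q] (∣ A ∣) (∣ N G A ∣) (∣ B ∣) (∣ N G B ∣) ⟩
  + (∣ A ∣ ℕ.+ ∣ B ∣) - + (∣ N G A ∣ ℕ.+ ∣ N G B ∣)
    ≡⟨ cong (λ k → + k - + (∣ N G A ∣ ℕ.+ ∣ N G B ∣)) (sym (∣p∪q∣+∣p∩q∣≡∣p∣+∣q∣ A B)) ⟩
  + (∣ A ∪ B ∣ ℕ.+ ∣ A ∩ B ∣) - + (∣ N G A ∣ ℕ.+ ∣ N G B ∣)
    ≤⟨ +-monoʳ-≤ (+ (∣ A ∪ B ∣ ℕ.+ ∣ A ∩ B ∣)) (neg-mono-≤ (+≤+ (∣N∪∣+∣N∩∣≤∣N∣+∣N∣ G A B))) ⟩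
  + (∣ A ∪ B ∣ ℕ.+ ∣ A ∩ B ∣) - + (∣ N G (A ∪ B) ∣ ℕ.+ ∣ N G (A ∩ B) ∣)
    ≡⟨ sym (+-[m-n]+[p-q]≡[m+p]-[n+q] (∣ A ∪ B ∣) (∣ N G (A ∪ B) ∣) (∣ A ∩ B ∣) (∣ N G (A ∩ B) ∣)) ⟩
  d G (A ∪ B) + d G (A ∩ B) ∎
  where open ≤-Reasoning

corollary2p9 : ∀ {n} (G : Graph n) (X : Subset n) → Independent G X → 0ℤ < d G X →
    (∀ Y → Y ⊂ X → d G Y < d G X) → ∀ x → x ∈ X → x ∈ker G
corollary2p9 G X _ _ minimal x x∈X A critical with x ∈? A
... | yes x∈A = x∈A
... | no  x∉A = contradiction (d-supermodular G A X)
  (<⇒≱ (+-mono-≤-< (critical (A ∪ X)) (minimal (A ∩ X) A∩X⊂X)))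
  where
  A∩X⊂X : A ∩ X ⊂ X
  A∩X⊂X = p∩q⊆q A X , x , x∈X , x∉A ∘ proj₁ ∘ x∈p∩q⁻ A X
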